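{- Let $G$ be a graph with a unique maximum open packing $U(G)$, and let $xy$ be a cut edge of $G$ such that neither $x$ nor $y$ belongs to $U(G)$, yet $N(x)\cap U(G)\neq\emptyset$ and $N(y)\cap U(G)\neq\emptyset$. If $G'$ is obtained from $G$ by subdividing the edge $xy$ with a new vertex $b$ (so $b$ is adjacent to $x$ and $y$ and $xy$ is removed) and adding a new leaf $a$ adjacent to $b$, then $G'$ has a unique maximum open packing.
   Context: An open packing in a graph is a set of vertices whose open neighborhoods are pairwise disjoint; a maximum open packing is one of maximum cardinality. A cut edge is an edge that lies on no cycle. -}

module Defs where

open import Data.Nat using (ℕ; suc; _≤_)
open import Data.Fin using (Fin; zero; suc; _≟_)
open import Data.Fin.Subset using (Subset; _∈_; _∉_; ∣_∣)
open import Data.Bool using (Bool; true; false; _∧_; _∨_; not)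
open import Data.List using (List; []; _∷_; _++_)
open import Data.List.Relation.Unary.Unique.Propositional using (Unique)
open import Data.Product using (Σ; _×_; ∃-syntax)
open import Relation.Nullary using (¬_)
open import Relation.Nullary.Decidable using (⌊_⌋)
open import Relation.Binary.PropositionalEquality using (_≡_; _≢_)

Graph : ℕ → Set
Graph n = Fin n → Fin n → Bool

Adj : ∀ {n} → Graph n → Fin n → Fin n → Set
Adj G u v = G u v ≡ true

IsSimple : ∀ {n} → Graph n → Set
IsSimple {n} G = (∀ u v → G u v ≡ G v u) × (∀ u → G u u ≡ false)

IsOpenPacking : ∀ {n} → Graph n → Subset n → Set
IsOpenPacking {n} G S =
  ∀ (u v w : Fin n) → u ∈ S → v ∈ S → Adj G u w → Adj G v w → u ≡ v

IsMaxOpenPacking : ∀ {n} → Graph n → Subset n → Set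
IsMaxOpenPacking {n} G S =
  IsOpenPacking G S × (∀ (T : Subset n) → IsOpenPacking G T → ∣ T ∣ ≤ ∣ S ∣)

IsUniqueMaxOpenPacking : ∀ {n} → Graph n → Subset n → Set
IsUniqueMaxOpenPacking {n} G S =
  IsMaxOpenPacking G S × (∀ (T : Subset n) → IsMaxOpenPacking G T → T ≡ S)

HasUniqueMaxOpenPacking : ∀ {n} → Graph n → Set
HasUniqueMaxOpenPacking {n} G = Σ (Subset n) (IsUniqueMaxOpenPacking G)

AdjChain : ∀ {n} → Graph n → List (Fin n) → Set
AdjChain G [] = Data.Unit.⊤ where import Data.Unit
AdjChain G (u ∷ []) = Data.Unit.⊤ where import Data.Unit
AdjChain G (u ∷ v ∷ vs) = Adj G u v × AdjChain G (v ∷ vs)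

OnCycle : ∀ {n} → Graph n → Fin n → Fin n → Set
OnCycle {n} G x y =
  ∃[ w ] (w ≢ [] × Unique (x ∷ y ∷ w) × AdjChain G (x ∷ y ∷ w ++ x ∷ []))

IsCutEdge : ∀ {n} → Graph n → Fin n → Fin n → Set
IsCutEdge G x y = Adj G x y × ¬ OnCycle G x y

isEdgeXY : ∀ {n} → Fin n → Fin n → Fin n → Fin n → Bool
isEdgeXY x y u v = (⌊ u ≟ x ⌋ ∧ ⌊ v ≟ y ⌋) ∨ (⌊ u ≟ y ⌋ ∧ ⌊ v ≟ x ⌋)

-- G' : subdivide xy by a new vertex b and attach a new leaf a to b.
-- Vertices of G' are Fin (suc (suc n)): b = zero, a = suc zero,
-- and an old vertex v of G is suc (suc v).
subdivideAddLeaf : ∀ {n} → Graph n → Fin n → Fin n → Graph (suc (suc n))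
subdivideAddLeaf G x y zero zero = false
subdivideAddLeaf G x y zero (suc zero) = true
subdivideAddLeaf G x y zero (suc (suc v)) = ⌊ v ≟ x ⌋ ∨ ⌊ v ≟ y ⌋
subdivideAddLeaf G x y (suc zero) zero = true
subdivideAddLeaf G x y (suc zero) (suc _) = false
subdivideAddLeaf G x y (suc (suc u)) zero = ⌊ u ≟ x ⌋ ∨ ⌊ u ≟ y ⌋
subdivideAddLeaf G x y (suc (suc u)) (suc zero) = false
subdivideAddLeaf G x y (suc (suc u)) (suc (suc v)) =
  G u v ∧ not (isEdgeXY x y u v)

-- Let H be G with the edge xy deleted and X the vertices
-- reachable from x in H; since xy is a cut edge, y ∉ X.  For open packings
-- P, Q of H let splice X P Q take P inside X and Q outside X.  It is an open
-- packing of G as soon as the edge xy causes no conflict, and the two splices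
-- of P and Q have together exactly ∣ P ∣ + ∣ Q ∣ elements.  Splicing an open
-- packing S of H with U (or with U minus the H-neighbour u₂ of y) and using
-- that U is the unique maximum open packing of G bounds ∣ S ∣ by ∣ U ∣, with
-- the defect 1 or 2 required by the extra vertices a, b of G′.  A case
-- analysis on which of a, b, x, y an open packing of G′ contains then shows
-- that every open packing of G′ other than U ∪ {a} has at most ∣ U ∣ vertices.
module Submission where

open import Defs
open import Data.Nat using (ℕ; zero; suc; _+_; _≤_; _≤′_; ≤′-refl; ≤′-step; _≤?_; z≤n; s≤s; s≤s⁻¹)
open import Data.Nat.Properties
  using (≤⇒≤′; ≰⇒>; n≤1+n; ≤-trans; ≤-refl; <⇒≤; <⇒≱; ≤∧≢⇒<; +-suc; +-assoc; +-mono-≤;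
         +-cancelʳ-≤; +-commutativeSemigroup; module ≤-Reasoning)
open import Algebra.Properties.CommutativeSemigroup +-commutativeSemigroup using (interchange)
open import Data.Bool using (true; false; _∧_; _∨_; not)
import Data.Bool.Properties as Bool
open import Data.Fin using (Fin; zero; suc; _≟_)
import Data.Fin as Fin
open import Data.Fin.Properties using (any?; pigeonhole)
open import Data.Fin.Subset using (Subset; _∈_; _∉_; _⊆_; ∣_∣; ∁; _∩_; _∪_; _-_)
open import Data.Fin.Subset.Properties
  using (_∈?_; x∈p∪q⁻; x∈p∩q⁻; x∈∁p⇒x∉p; x∉p⇒x∈∁p; x∈p⇒x∉∁p; p─q⊆p; p─⊥≡p)
open import Data.Vec using ([]; _∷_; tabulate; here; there)
open import Data.Vec.Properties using (lookup∘tabulate; []=⇒lookup; lookup⇒[]=; ≡-dec)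
open import Data.List using (List; []; _∷_; _++_; length)
import Data.List as List
open import Data.List.Relation.Unary.All as All using ([]; _∷_)
open import Data.List.Relation.Unary.All.Properties using (¬Any⇒All¬)
open import Data.List.Relation.Unary.Any using () renaming (here to hereₗ; there to thereₗ)
open import Data.List.Relation.Unary.AllPairs using ([]; _∷_)
open import Data.List.Relation.Unary.Unique.Propositional using (Unique)
open import Data.List.Relation.Binary.Permutation.Propositional using (↭-sym; ↭⇒↭ₛ)
open import Data.List.Relation.Binary.Permutation.Propositional.Properties using (∷↭∷ʳ)
import Data.List.Relation.Binary.Permutation.Setoid.Properties as Permutation
open import Data.List.Membership.Propositional using () renaming (_∈_ to _∈ₗ_)
open import Data.List.Membership.Propositional.Properties using (∈-lookup)
open import Data.Product using (_×_; _,_; proj₁; proj₂; ∃-syntax)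
open import Data.Sum using (_⊎_; inj₁; inj₂; map₂; swap)
open import Data.Empty using (⊥; ⊥-elim)
open import Function using (_∘_)
open import Data.Unit using (tt)
open import Relation.Nullary using (Dec; yes; no; does; ¬_; contradiction)
open import Relation.Nullary.Decidable using (⌊_⌋; dec-true; _×-dec_; _⊎-dec_)
open import Relation.Binary.PropositionalEquality
  using (_≡_; _≢_; refl; sym; trans; cong; cong₂; subst; setoid)

does-true : ∀ {A : Set} (a? : Dec A) → does a? ≡ true → A
does-true (yes a) _ = a

subsetOf : ∀ {n} {P : Fin n → Set} → (∀ v → Dec (P v)) → Subset n
subsetOf P? = tabulate (λ v → does (P? v))

∈-subsetOf⁺ : ∀ {n} {P : Fin n → Set} (P? : ∀ v → Dec (P v)) {v} → P v → v ∈ subsetOf P?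
∈-subsetOf⁺ P? {v} p = lookup⇒[]= v _ (trans (lookup∘tabulate _ v) (dec-true (P? v) p))

∈-subsetOf⁻ : ∀ {n} {P : Fin n → Set} (P? : ∀ v → Dec (P v)) {v} → v ∈ subsetOf P? → P v
∈-subsetOf⁻ P? {v} v∈ = does-true (P? v) (trans (sym (lookup∘tabulate _ v)) ([]=⇒lookup v∈))

∨-true : ∀ {a b} → a ∨ b ≡ true → a ≡ true ⊎ b ≡ true
∨-true {true} _ = inj₁ refl
∨-true {false} b = inj₂ b

∧-true : ∀ {a b} → a ∧ b ≡ true → a ≡ true × b ≡ true
∧-true {true} b = refl , b

≟-true : ∀ {n} {u v : Fin n} → ⌊ u ≟ v ⌋ ≡ true → u ≡ v
≟-true {u = u} {v} _ with u ≟ v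
... | yes u≡v = u≡v

≟-refl : ∀ {n} (u : Fin n) → ⌊ u ≟ u ⌋ ≡ true
≟-refl u with u ≟ u
... | yes _ = refl
... | no u≢u = contradiction refl u≢u

unique-length : ∀ {n} (l : List (Fin n)) → Unique l → length l ≤ n
unique-length {n} l l-unique with length l ≤? n
... | yes l≤n = l≤n
... | no l≰n with pigeonhole (≰⇒> l≰n) (List.lookup l)
...   | i , j , i<j , same = ⊥-elim (distinct l l-unique i j i<j same)
  where
  distinct : ∀ (xs : List (Fin n)) → Unique xs → ∀ i j → i Fin.< j →
    List.lookup xs i ≢ List.lookup xs j
  distinct (a ∷ xs) (a∉xs ∷ _) zero (suc j) _ = All.lookup a∉xs (∈-lookup j)
  distinct (a ∷ xs) (_ ∷ xs-unique) (suc i) (suc j) i<j =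
    distinct xs xs-unique i j (s≤s⁻¹ i<j)

unique-rotate : ∀ {A : Set} (l : List A) {z} → Unique (l ++ z ∷ []) → Unique (z ∷ l)
unique-rotate {A} l {z} =
  Permutation.Unique-resp-↭ (setoid A) (↭⇒↭ₛ (↭-sym (∷↭∷ʳ z l)))

chain-mono : ∀ {n} {H G : Graph n} → (∀ {u v} → Adj H u v → Adj G u v) →
  ∀ l → AdjChain H l → AdjChain G l
chain-mono H⊆G [] _ = tt
chain-mono H⊆G (u ∷ []) _ = tt
chain-mono H⊆G (u ∷ v ∷ l) (uv , e) = H⊆G uv , chain-mono H⊆G (v ∷ l) e

module Component {n : ℕ} (H : Graph n) (H-sym : ∀ {u v} → Adj H u v → Adj H v u)
  (x : Fin n) where

  open import Data.List.Membership.DecPropositional (_≟_ {n}) using ()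
    renaming (_∈?_ to _∈ₗ?_)

  EndsAtX : Fin n → List (Fin n) → Set
  EndsAtX v [] = v ≡ x
  EndsAtX _ (w ∷ l) = EndsAtX w l

  ends-split : ∀ {v} l → EndsAtX v l → (l ≡ [] × v ≡ x) ⊎ ∃[ w ] (l ≡ w ++ x ∷ [])
  ends-split [] t = inj₁ (refl , t)
  ends-split (u ∷ l) t with ends-split l t
  ... | inj₁ (refl , refl) = inj₂ ([] , refl)
  ... | inj₂ (w , refl) = inj₂ (u ∷ w , refl)

  -- A simple path v = v₀, v₁, …, vₖ = x in H, recorded by its route v₁ … vₖ.
  record PathToX (v : Fin n) : Set where
    constructor path
    field
      route    : List (Fin n)
      distinct : Unique (v ∷ route)
      edges    : AdjChain H (v ∷ route)
      ends     : EndsAtX v route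

  from-vertex : ∀ {v w} l → w ∈ₗ (v ∷ l) → Unique (v ∷ l) → AdjChain H (v ∷ l) →
    EndsAtX v l → PathToX w
  from-vertex l (hereₗ refl) d e t = path l d e t
  from-vertex (u ∷ l) (thereₗ w∈) (_ ∷ d) (_ , e) t = from-vertex l w∈ d e t

  -- Prepend a neighbour to a path, cutting the path short if it already
  -- passes through that neighbour.
  extend : ∀ {v w} → Adj H w v → PathToX v → PathToX w
  extend {v} {w} wv (path l d e t) with w ∈ₗ? (v ∷ l)
  ... | yes w∈ = from-vertex l w∈ d e t
  ... | no w∉ = path (v ∷ l) (¬Any⇒All¬ (v ∷ l) w∉ ∷ d) (wv , e) t

  Reach : ℕ → Fin n → Set
  Reach zero v = v ≡ x
  Reach (suc k) v = Reach k v ⊎ ∃[ u ] (Adj H v u × Reach k u)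

  reach? : ∀ k v → Dec (Reach k v)
  reach? zero v = v ≟ x
  reach? (suc k) v =
    reach? k v ⊎-dec any? (λ u → (H v u Bool.≟ true) ×-dec reach? k u)

  reach-mono : ∀ {k m v} → k ≤′ m → Reach k v → Reach m v
  reach-mono ≤′-refl r = r
  reach-mono (≤′-step k≤m) r = inj₁ (reach-mono k≤m r)

  reach⇒path : ∀ k {v} → Reach k v → PathToX v
  reach⇒path zero refl = path [] ([] ∷ []) tt refl
  reach⇒path (suc k) (inj₁ r) = reach⇒path k r
  reach⇒path (suc k) (inj₂ (u , vu , r)) = extend vu (reach⇒path k r)

  walk⇒reach : ∀ {v} l → AdjChain H (v ∷ l) → EndsAtX v l → Reach (length l) v
  walk⇒reach [] _ t = t
  walk⇒reach (u ∷ l) (vu , e) t = inj₂ (u , vu , walk⇒reach l e t)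

  -- Walks with n edges reach everything: a simple path has fewer than n edges.
  path⇒reach : ∀ {v} → PathToX v → Reach n v
  path⇒reach {v} (path l d e t) =
    reach-mono (≤⇒≤′ (≤-trans (n≤1+n _) (unique-length (v ∷ l) d))) (walk⇒reach l e t)

  component : Subset n
  component = subsetOf (reach? n)

  x∈component : x ∈ component
  x∈component = ∈-subsetOf⁺ (reach? n) (reach-mono (≤⇒≤′ z≤n) refl)

  component-path : ∀ {v} → v ∈ component → PathToX v
  component-path v∈ = reach⇒path n (∈-subsetOf⁻ (reach? n) v∈)

  component-closed : ∀ {u v} → Adj H u v → u ∈ component → v ∈ component
  component-closed uv u∈ =
    ∈-subsetOf⁺ (reach? n) (path⇒reach (extend (H-sym uv) (component-path u∈)))

isEdgeXY-true : ∀ {n} {x y u v : Fin n} → isEdgeXY x y u v ≡ true →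
  (u ≡ x × v ≡ y) ⊎ (u ≡ y × v ≡ x)
isEdgeXY-true e with ∨-true e
... | inj₁ uxvy = inj₁ (≟-true (proj₁ (∧-true uxvy)) , ≟-true (proj₂ (∧-true uxvy)))
... | inj₂ uyvx = inj₂ (≟-true (proj₁ (∧-true uyvx)) , ≟-true (proj₂ (∧-true uyvx)))

isEdgeXY-sym : ∀ {n} (x y u v : Fin n) → isEdgeXY x y u v ≡ isEdgeXY x y v u
isEdgeXY-sym x y u v =
  trans (Bool.∨-comm (⌊ u ≟ x ⌋ ∧ ⌊ v ≟ y ⌋) (⌊ u ≟ y ⌋ ∧ ⌊ v ≟ x ⌋))
        (cong₂ _∨_ (Bool.∧-comm (⌊ u ≟ y ⌋) (⌊ v ≟ x ⌋))
                   (Bool.∧-comm (⌊ u ≟ x ⌋) (⌊ v ≟ y ⌋)))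

isEdgeXY-yx : ∀ {n} (x y : Fin n) → isEdgeXY x y y x ≡ true
isEdgeXY-yx x y =
  trans (cong₂ (λ a b → (⌊ y ≟ x ⌋ ∧ ⌊ x ≟ y ⌋) ∨ (a ∧ b)) (≟-refl y) (≟-refl x))
        (Bool.∨-zeroʳ _)

-- G with the edge xy removed.  On the old vertices, subdivideAddLeaf G x y
-- is exactly this graph.
deleteEdge : ∀ {n} → Graph n → Fin n → Fin n → Graph n
deleteEdge G x y u v = G u v ∧ not (isEdgeXY x y u v)

module EdgeDeletion {n} (G : Graph n) (x y : Fin n) where

  H : Graph n
  H = deleteEdge G x y

  H⊆G : ∀ {u v} → Adj H u v → Adj G u v
  H⊆G uv = proj₁ (∧-true uv)

  H-sym : (∀ u v → G u v ≡ G v u) → ∀ {u v} → Adj H u v → Adj H v u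
  H-sym G-sym {u} {v} uv =
    trans (cong₂ (λ a b → a ∧ not b) (G-sym v u) (isEdgeXY-sym x y v u)) uv

  G⊆H+xy : ∀ {u v} → Adj G u v → Adj H u v ⊎ ((u ≡ x × v ≡ y) ⊎ (u ≡ y × v ≡ x))
  G⊆H+xy {u} {v} uv with isEdgeXY x y u v in e
  ... | true = inj₂ (isEdgeXY-true e)
  ... | false = inj₁ (cong (_∧ true) uv)

  yx∉H : ¬ Adj H y x
  yx∉H yx with () ← trans (cong not (sym (isEdgeXY-yx x y))) (proj₂ (∧-true yx))

  -- If xy is a cut edge, then y cannot be reached from x once xy is deleted:
  -- a path from y to x in H closes up with xy to a cycle through xy.
  module Cut (G-sym : ∀ u v → G u v ≡ G v u) (cut : IsCutEdge G x y) (x≢y : x ≢ y) where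

    open Component H (H-sym G-sym) x public

    y∉component : y ∉ component
    y∉component y∈ with component-path y∈
    ... | path l d e t with ends-split l t
    ...   | inj₁ (_ , y≡x) = x≢y (sym y≡x)
    ...   | inj₂ ([] , refl) = yx∉H (proj₁ e)
    ...   | inj₂ (a ∷ w , refl) =
      proj₂ cut (a ∷ w , (λ ()) , unique-rotate (y ∷ a ∷ w) d ,
                 proj₁ cut , chain-mono H⊆G (y ∷ a ∷ w ++ x ∷ []) e)

NoNeighbour : ∀ {n} → Graph n → Fin n → Subset n → Set
NoNeighbour K z S = ∀ q → q ∈ S → ¬ Adj K q z

∈∉⇒≢ : ∀ {n} {S : Subset n} {u v} → u ∈ S → v ∉ S → u ≢ v
∈∉⇒≢ u∈ v∉ refl = v∉ u∈

packing-⊆ : ∀ {n} {K : Graph n} {S T : Subset n} → S ⊆ T → IsOpenPacking K T →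
  IsOpenPacking K S
packing-⊆ S⊆T T-pack u v w u∈ v∈ = T-pack u v w (S⊆T u∈) (S⊆T v∈)

packing-subgraph : ∀ {n} {H G : Graph n} {S : Subset n} →
  (∀ {u v} → Adj H u v → Adj G u v) → IsOpenPacking G S → IsOpenPacking H S
packing-subgraph H⊆G S-pack u v w u∈ v∈ uw vw = S-pack u v w u∈ v∈ (H⊆G uw) (H⊆G vw)

unique-max-strict : ∀ {n} {G : Graph n} {U T : Subset n} → IsUniqueMaxOpenPacking G U →
  IsOpenPacking G T → T ≢ U → suc ∣ T ∣ ≤ ∣ U ∣
unique-max-strict ((_ , U-max) , U-unique) T-pack T≢U =
  ≤∧≢⇒< (U-max _ T-pack) λ |T|≡|U| →
    T≢U (U-unique _ (T-pack , λ S S-pack → subst (∣ S ∣ ≤_) (sym |T|≡|U|) (U-max S S-pack)))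

unique-max-intro : ∀ {n} {G : Graph n} {U : Subset n} → IsOpenPacking G U →
  (∀ S → IsOpenPacking G S → S ≡ U ⊎ suc ∣ S ∣ ≤ ∣ U ∣) → IsUniqueMaxOpenPacking G U
unique-max-intro {U = U} U-pack beats = (U-pack , maximum) , unique
  where
  maximum : ∀ S → IsOpenPacking _ S → ∣ S ∣ ≤ ∣ U ∣
  maximum S S-pack with beats S S-pack
  ... | inj₁ refl = ≤-refl
  ... | inj₂ S<U = <⇒≤ S<U
  unique : ∀ S → IsMaxOpenPacking _ S → S ≡ U
  unique S (S-pack , S-max) with beats S S-pack
  ... | inj₁ S≡U = S≡U
  ... | inj₂ S<U = contradiction (S-max U U-pack) (<⇒≱ S<U)

missing⇒≢ : ∀ {n} {T U : Subset n} {v} → v ∈ U → v ∉ T → T ≢ U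
missing⇒≢ v∈U v∉T refl = v∉T v∈U

∉-remove : ∀ {n} (S : Subset n) v → v ∉ S - v
∉-remove (_ ∷ S) zero ()
∉-remove (_ ∷ S) (suc v) (there v∈) = ∉-remove S v v∈

size-remove : ∀ {n} {S : Subset n} {v} → v ∈ S → ∣ S ∣ ≡ suc ∣ S - v ∣
size-remove {S = true ∷ S} here = cong (λ T → suc ∣ T ∣) (sym (p─⊥≡p S))
size-remove {S = true ∷ S} (there v∈) = cong suc (size-remove v∈)
size-remove {S = false ∷ S} (there v∈) = size-remove v∈

splice : ∀ {n} → Subset n → Subset n → Subset n → Subset n
splice X P Q = (X ∩ P) ∪ (∁ X ∩ Q)

∈-splice : ∀ {n} {X P Q : Subset n} {v} → v ∈ splice X P Q →
  (v ∈ X × v ∈ P) ⊎ (v ∉ X × v ∈ Q)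
∈-splice {X = X} {P} {Q} v∈ with x∈p∪q⁻ (X ∩ P) (∁ X ∩ Q) v∈
... | inj₁ v∈X∩P = inj₁ (x∈p∩q⁻ X P v∈X∩P)
... | inj₂ v∈∁X∩Q with x∈p∩q⁻ (∁ X) Q v∈∁X∩Q
...   | v∈∁X , v∈Q = inj₂ (x∈∁p⇒x∉p v∈∁X , v∈Q)

splice-inside : ∀ {n} {X P Q : Subset n} {v} → v ∈ X → v ∈ splice X P Q → v ∈ P
splice-inside {X = X} v∈X v∈ with ∈-splice {X = X} v∈
... | inj₁ (_ , v∈P) = v∈P
... | inj₂ (v∉X , _) = contradiction v∈X v∉X

splice-outside : ∀ {n} {X P Q : Subset n} {v} → v ∉ X → v ∈ splice X P Q → v ∈ Q
splice-outside {X = X} v∉X v∈ with ∈-splice {X = X} v∈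
... | inj₁ (v∈X , _) = contradiction v∈X v∉X
... | inj₂ (_ , v∈Q) = v∈Q

size-∷-swap : ∀ {n} a b (A B : Subset n) → ∣ a ∷ A ∣ + ∣ b ∷ B ∣ ≡ ∣ b ∷ A ∣ + ∣ a ∷ B ∣
size-∷-swap true true A B = refl
size-∷-swap true false A B = sym (+-suc ∣ A ∣ ∣ B ∣)
size-∷-swap false true A B = +-suc ∣ A ∣ ∣ B ∣
size-∷-swap false false A B = refl

size-∷-cong : ∀ {n} a b {A B P Q : Subset n} → ∣ A ∣ + ∣ B ∣ ≡ ∣ P ∣ + ∣ Q ∣ →
  ∣ a ∷ A ∣ + ∣ b ∷ B ∣ ≡ ∣ a ∷ P ∣ + ∣ b ∷ Q ∣
size-∷-cong true true {A} {B} {P} {Q} e =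
  cong suc (trans (+-suc ∣ A ∣ ∣ B ∣) (trans (cong suc e) (sym (+-suc ∣ P ∣ ∣ Q ∣))))
size-∷-cong true false e = cong suc e
size-∷-cong false true {A} {B} {P} {Q} e =
  trans (+-suc ∣ A ∣ ∣ B ∣) (trans (cong suc e) (sym (+-suc ∣ P ∣ ∣ Q ∣)))
size-∷-cong false false e = e

splice-size : ∀ {n} (X P Q : Subset n) →
  ∣ splice X P Q ∣ + ∣ splice X Q P ∣ ≡ ∣ P ∣ + ∣ Q ∣
splice-size [] [] [] = refl
splice-size (true ∷ X) (p ∷ P) (q ∷ Q)
  rewrite Bool.∨-identityʳ p | Bool.∨-identityʳ q =
  size-∷-cong p q {splice X P Q} {splice X Q P} {P} {Q} (splice-size X P Q)
splice-size (false ∷ X) (p ∷ P) (q ∷ Q) =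
  trans (size-∷-swap q p (splice X P Q) (splice X Q P))
        (size-∷-cong p q {splice X P Q} {splice X Q P} {P} {Q} (splice-size X P Q))

splice-bound : ∀ {n} (X P Q : Subset n) {u} i j →
  i + ∣ splice X P Q ∣ ≤ u → j + ∣ splice X Q P ∣ ≤ u → i + j + ∣ P ∣ + ∣ Q ∣ ≤ u + u
splice-bound X P Q {u} i j PQ≤u QP≤u = begin
  i + j + ∣ P ∣ + ∣ Q ∣                    ≡⟨ +-assoc (i + j) ∣ P ∣ ∣ Q ∣ ⟩
  i + j + (∣ P ∣ + ∣ Q ∣)                  ≡⟨ cong (i + j +_) (sym (splice-size X P Q)) ⟩
  i + j + (∣ splice X P Q ∣ + ∣ splice X Q P ∣)
    ≡⟨ interchange i j ∣ splice X P Q ∣ ∣ splice X Q P ∣ ⟩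
  (i + ∣ splice X P Q ∣) + (j + ∣ splice X Q P ∣) ≤⟨ +-mono-≤ PQ≤u QP≤u ⟩
  u + u                                    ∎
  where open ≤-Reasoning

module Splicing {n} {G H : Graph n} {x y : Fin n}
  (H-sym : ∀ {u v} → Adj H u v → Adj H v u)
  (G⊆H+xy : ∀ {u v} → Adj G u v → Adj H u v ⊎ ((u ≡ x × v ≡ y) ⊎ (u ≡ y × v ≡ x)))
  {X : Subset n} (x∈X : x ∈ X) (y∉X : y ∉ X)
  (X-closed : ∀ {u v} → Adj H u v → u ∈ X → v ∈ X) where

  edge-away : ∀ {u w} → u ≢ x → u ≢ y → Adj G u w → Adj H u w
  edge-away u≢x u≢y uw with G⊆H+xy uw
  ... | inj₁ uw′ = uw′
  ... | inj₂ (inj₁ (u≡x , _)) = contradiction u≡x u≢x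
  ... | inj₂ (inj₂ (u≡y , _)) = contradiction u≡y u≢y

  edge-inside : ∀ {u w} → u ∈ X → Adj G u w → Adj H u w ⊎ (u ≡ x × w ≡ y)
  edge-inside u∈X uw with G⊆H+xy uw
  ... | inj₁ uw′ = inj₁ uw′
  ... | inj₂ (inj₁ u≡x×w≡y) = inj₂ u≡x×w≡y
  ... | inj₂ (inj₂ (refl , _)) = contradiction u∈X y∉X

  packing-avoiding : ∀ {S} → IsOpenPacking H S → x ∉ S → y ∉ S → IsOpenPacking G S
  packing-avoiding S-pack x∉S y∉S u v w u∈ v∈ uw vw =
    S-pack u v w u∈ v∈ (edge-away (∈∉⇒≢ u∈ x∉S) (∈∉⇒≢ u∈ y∉S) uw)
                       (edge-away (∈∉⇒≢ v∈ x∉S) (∈∉⇒≢ v∈ y∉S) vw)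

  edge-outside : ∀ {q w} → q ∉ X → q ≢ y → Adj G q w → Adj H q w
  edge-outside q∉X = edge-away (∈∉⇒≢ x∈X q∉X ∘ sym)

  inside-pair : ∀ {P p q w} → IsOpenPacking H P → p ∈ X → p ∈ P → q ∈ X → q ∈ P →
    Adj G p w → Adj G q w → p ≡ q
  inside-pair P-pack p∈X p∈P q∈X q∈P pw qw with edge-inside p∈X pw | edge-inside q∈X qw
  ... | inj₁ pw′ | inj₁ qw′ = P-pack _ _ _ p∈P q∈P pw′ qw′
  ... | inj₁ pw′ | inj₂ (_ , refl) = contradiction (X-closed pw′ p∈X) y∉X
  ... | inj₂ (_ , refl) | inj₁ qw′ = contradiction (X-closed qw′ q∈X) y∉X
  ... | inj₂ (refl , _) | inj₂ (refl , _) = refl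

  -- When the edge xy creates no conflict -- y ∉ Q, and if x ∈ P then no
  -- vertex of Q is adjacent to y in H -- a vertex of P inside X and a vertex
  -- of Q outside X have no common neighbour in G: such a neighbour would lie
  -- outside X, forcing the first vertex to be x and the neighbour to be y.
  crossing : ∀ {P Q p q w} → y ∉ Q → (x ∈ P → NoNeighbour H y Q) →
    p ∈ X → p ∈ P → q ∉ X → q ∈ Q → Adj G p w → Adj G q w → ⊥
  crossing y∉Q xy-free p∈X p∈P q∉X q∈Q pw qw with edge-inside p∈X pw
  ... | inj₁ pw′ =
    q∉X (X-closed (H-sym (edge-outside q∉X (∈∉⇒≢ q∈Q y∉Q) qw)) (X-closed pw′ p∈X))
  ... | inj₂ (refl , refl) = xy-free p∈P _ q∈Q (edge-outside q∉X (∈∉⇒≢ q∈Q y∉Q) qw)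

  splice-packing : ∀ {P Q} → IsOpenPacking H P → IsOpenPacking H Q → y ∉ Q →
    (x ∈ P → NoNeighbour H y Q) → IsOpenPacking G (splice X P Q)
  splice-packing P-pack Q-pack y∉Q xy-free u v w u∈ v∈ uw vw
    with ∈-splice {X = X} u∈ | ∈-splice {X = X} v∈
  ... | inj₁ (u∈X , u∈P) | inj₁ (v∈X , v∈P) = inside-pair P-pack u∈X u∈P v∈X v∈P uw vw
  ... | inj₂ (u∉X , u∈Q) | inj₂ (v∉X , v∈Q) =
    Q-pack u v w u∈Q v∈Q (edge-outside u∉X (∈∉⇒≢ u∈Q y∉Q) uw)
                         (edge-outside v∉X (∈∉⇒≢ v∈Q y∉Q) vw)
  ... | inj₁ (u∈X , u∈P) | inj₂ (v∉X , v∈Q) =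
    ⊥-elim (crossing y∉Q xy-free u∈X u∈P v∉X v∈Q uw vw)
  ... | inj₂ (u∉X , u∈Q) | inj₁ (v∈X , v∈P) =
    ⊥-elim (crossing y∉Q xy-free v∈X v∈P u∉X u∈Q vw uw)

  -- Each open packing S of H is bounded by gluing it with U (or U - u₂).
  module Comparison (H⊆G : ∀ {u v} → Adj H u v → Adj G u v)
    {U : Subset n} (U-unique : IsUniqueMaxOpenPacking G U) (x∉U : x ∉ U) (y∉U : y ∉ U)
    {u₁} (u₁∈U : u₁ ∈ U) (u₁x : Adj H u₁ x) {u₂} (u₂∈U : u₂ ∈ U) (u₂y : Adj H u₂ y)
    {S : Subset n} (S-pack : IsOpenPacking H S) where

    U-pack : IsOpenPacking G U
    U-pack = proj₁ (proj₁ U-unique)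

    U-packᴴ : IsOpenPacking H U
    U-packᴴ = packing-subgraph H⊆G U-pack

    u₁∈X : u₁ ∈ X
    u₁∈X = X-closed (H-sym u₁x) x∈X

    u₂∉X : u₂ ∉ X
    u₂∉X u₂∈X = y∉X (X-closed u₂y u₂∈X)

    avoiding-bound : x ∉ S → y ∉ S → S ≡ U ⊎ suc ∣ S ∣ ≤ ∣ U ∣
    avoiding-bound x∉S y∉S with ≡-dec Bool._≟_ S U
    ... | yes S≡U = inj₁ S≡U
    ... | no S≢U = inj₂ (unique-max-strict U-unique (packing-avoiding S-pack x∉S y∉S) S≢U)

    avoiding-bound-x : x ∉ S → y ∉ S → NoNeighbour H x S → suc ∣ S ∣ ≤ ∣ U ∣
    avoiding-bound-x x∉S y∉S no-x = unique-max-strict U-unique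
      (packing-avoiding S-pack x∉S y∉S) (missing⇒≢ u₁∈U λ u₁∈S → no-x _ u₁∈S u₁x)

    -- If no vertex of S is adjacent to x or to y, then S has at least two
    -- vertices fewer: U ∩ X glued to S ∖ X misses u₂, S ∩ X glued to U ∖ X
    -- misses u₁, and together the two have as many vertices as U and S.
    avoiding-bound-xy : x ∉ S → y ∉ S → NoNeighbour H x S →
      NoNeighbour H y S → 2 + ∣ S ∣ ≤ ∣ U ∣
    avoiding-bound-xy x∉S y∉S no-x no-y =
      +-cancelʳ-≤ (∣ U ∣) (2 + ∣ S ∣) (∣ U ∣) (splice-bound X S U 1 1 S⊕U<U U⊕S<U)
      where
      S⊕U<U : suc ∣ splice X S U ∣ ≤ ∣ U ∣
      S⊕U<U = unique-max-strict U-unique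
        (splice-packing S-pack U-packᴴ y∉U (λ x∈S → contradiction x∈S x∉S))
        (missing⇒≢ u₁∈U λ u₁∈ → no-x _ (splice-inside u₁∈X u₁∈) u₁x)
      U⊕S<U : suc ∣ splice X U S ∣ ≤ ∣ U ∣
      U⊕S<U = unique-max-strict U-unique
        (splice-packing U-packᴴ S-pack y∉S (λ x∈U → contradiction x∈U x∉U))
        (missing⇒≢ u₂∈U λ u₂∈ → no-y _ (splice-outside u₂∉X u₂∈) u₂y)

    -- When S contains x but not y, it is compared with R = U minus u₂,
    -- which has one vertex fewer than U and no H-neighbour of y.
    R : Subset n
    R = U - u₂

    R⊆U : R ⊆ U
    R⊆U = p─q⊆p U _

    R-free : NoNeighbour H y R
    R-free q q∈R qy with U-packᴴ q u₂ y (R⊆U q∈R) u₂∈U qy u₂y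
    ... | refl = ∉-remove U u₂ q∈R

    R⊕S-pack : y ∉ S → IsOpenPacking G (splice X R S)
    R⊕S-pack y∉S = splice-packing (packing-⊆ R⊆U U-packᴴ) S-pack y∉S
      (λ x∈R → contradiction (R⊆U x∈R) x∉U)

    -- S ∩ X glued to R ∖ X is an open packing of G missing u₂, hence smaller
    -- than U.  As ∣ R ∣ + 1 = ∣ U ∣, any slack j in the size of the other
    -- splice carries over to S.
    containing-bound′ : x ∈ S → y ∉ S → ∀ j → j + ∣ splice X R S ∣ ≤ ∣ U ∣ →
      j + ∣ S ∣ ≤ ∣ U ∣
    containing-bound′ x∈S y∉S j R⊕S≤U = s≤s⁻¹ (+-cancelʳ-≤ (∣ R ∣) _ _ (begin
      suc (j + ∣ S ∣) + ∣ R ∣  ≤⟨ splice-bound X S R 1 j S⊕R<U R⊕S≤U ⟩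
      ∣ U ∣ + ∣ U ∣            ≡⟨ cong (∣ U ∣ +_) (size-remove u₂∈U) ⟩
      ∣ U ∣ + suc ∣ R ∣        ≡⟨ +-suc ∣ U ∣ ∣ R ∣ ⟩
      suc ∣ U ∣ + ∣ R ∣        ∎))
      where
      open ≤-Reasoning
      S⊕R<U : suc ∣ splice X S R ∣ ≤ ∣ U ∣
      S⊕R<U = unique-max-strict U-unique
        (splice-packing S-pack (packing-⊆ R⊆U U-packᴴ) (y∉U ∘ R⊆U) (λ _ → R-free))
        (missing⇒≢ u₂∈U λ u₂∈ → ∉-remove U u₂ (splice-outside u₂∉X u₂∈))

    containing-bound : x ∈ S → y ∉ S → ∣ S ∣ ≤ ∣ U ∣
    containing-bound x∈S y∉S =
      containing-bound′ x∈S y∉S 0 (proj₂ (proj₁ U-unique) _ (R⊕S-pack y∉S))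

    containing-bound-y : x ∈ S → y ∉ S → NoNeighbour H y S →
      suc ∣ S ∣ ≤ ∣ U ∣
    containing-bound-y x∈S y∉S no-y = containing-bound′ x∈S y∉S 1
      (unique-max-strict U-unique (R⊕S-pack y∉S)
        (missing⇒≢ u₂∈U λ u₂∈ → no-y _ (splice-outside u₂∉X u₂∈) u₂y))

module Subdivision {n} (G : Graph n) (x y : Fin n) where

  open EdgeDeletion G x y using (H; H⊆G)

  G′ : Graph (suc (suc n))
  G′ = subdivideAddLeaf G x y

  old : Fin n → Fin (suc (suc n))
  old v = suc (suc v)

  old-injective : ∀ {u v} → old u ≡ old v → u ≡ v
  old-injective refl = refl

  x∼b : Adj G′ (old x) zero
  x∼b = cong (_∨ ⌊ x ≟ y ⌋) (≟-refl x)

  y∼b : Adj G′ (old y) zero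
  y∼b = trans (cong (⌊ y ≟ x ⌋ ∨_) (≟-refl y)) (Bool.∨-zeroʳ _)

  old∼b : ∀ {v} → Adj G′ (old v) zero → v ≡ x ⊎ v ≡ y
  old∼b vb with ∨-true vb
  ... | inj₁ v≟x = inj₁ (≟-true v≟x)
  ... | inj₂ v≟y = inj₂ (≟-true v≟y)

  restrict : ∀ {sb sa S} → IsOpenPacking G′ (sb ∷ sa ∷ S) → IsOpenPacking H S
  restrict pack u v w u∈ v∈ uw vw =
    old-injective (pack (old u) (old v) (old w) (there (there u∈)) (there (there v∈)) uw vw)

  not-both : ∀ {sb sa S} → IsOpenPacking G′ (sb ∷ sa ∷ S) → x ∈ S → y ∈ S → x ≡ y
  not-both pack x∈ y∈ =
    old-injective (pack (old x) (old y) zero (there (there x∈)) (there (there y∈)) x∼b y∼b)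

  leaf-excludes : ∀ {sb S} → IsOpenPacking G′ (sb ∷ true ∷ S) →
    ∀ {v} → Adj G′ (old v) zero → v ∉ S
  leaf-excludes pack {v} vb v∈
    with () ← pack (suc zero) (old v) zero (there here) (there (there v∈)) refl vb

  centre-excludes : ∀ {sa S} → IsOpenPacking G′ (true ∷ sa ∷ S) →
    ∀ {z} → Adj G′ (old z) zero → NoNeighbour H z S
  centre-excludes pack {z} zb q q∈ qz
    with () ← pack zero (old q) (old z) here (there (there q∈)) zb qz

  withLeaf : Subset n → Subset (suc (suc n))
  withLeaf U = false ∷ true ∷ U

  extended-packing : ∀ {U} → IsOpenPacking G U → x ∉ U → y ∉ U →
    IsOpenPacking G′ (withLeaf U)
  extended-packing {U} U-pack x∉U y∉U = pack
    where
    off-b : ∀ {v} → v ∈ U → ¬ Adj G′ (old v) zero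
    off-b {v} v∈ vb with old∼b {v} vb
    ... | inj₁ refl = x∉U v∈
    ... | inj₂ refl = y∉U v∈
    pack : IsOpenPacking G′ (withLeaf U)
    pack _ _ _ (there here) (there here) _ _ = refl
    pack _ _ zero (there here) (there (there v∈)) _ vb = ⊥-elim (off-b v∈ vb)
    pack _ _ zero (there (there u∈)) _ ub _ = ⊥-elim (off-b u∈ ub)
    pack _ _ (suc zero) (there (there _)) _ () _
    pack _ _ (suc zero) (there here) (there (there _)) _ ()
    pack _ _ (suc (suc _)) (there here) _ () _
    pack _ _ (suc (suc _)) (there (there _)) (there here) _ ()
    pack _ _ (suc (suc w)) (there (there u∈)) (there (there v∈)) uw vw =
      cong old (U-pack _ _ w u∈ v∈ (H⊆G uw) (H⊆G vw))

  one-end : ∀ {U S : Subset n} {z z′} → z ∈ S →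
    Adj G′ (old z) zero → Adj G′ (old z′) zero →
    ∣ S ∣ ≤ ∣ U ∣ → (NoNeighbour H z′ S → suc ∣ S ∣ ≤ ∣ U ∣) →
    ∀ sb sa → IsOpenPacking G′ (sb ∷ sa ∷ S) → ∣ sb ∷ sa ∷ S ∣ ≤ ∣ U ∣
  one-end z∈ zb _ _ _ _ true pack = contradiction z∈ (leaf-excludes pack zb)
  one-end _ _ _ bound _ false false _ = bound
  one-end _ _ z′b _ bound-z′ true false pack = bound-z′ (centre-excludes pack z′b)

  neither-end : ∀ {U S : Subset n} → S ≡ U ⊎ suc ∣ S ∣ ≤ ∣ U ∣ →
    (NoNeighbour H x S → suc ∣ S ∣ ≤ ∣ U ∣) →
    (NoNeighbour H x S → NoNeighbour H y S → 2 + ∣ S ∣ ≤ ∣ U ∣) →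
    ∀ sb sa → IsOpenPacking G′ (sb ∷ sa ∷ S) →
    sb ∷ sa ∷ S ≡ withLeaf U ⊎ ∣ sb ∷ sa ∷ S ∣ ≤ ∣ U ∣
  neither-end (inj₁ refl) _ _ false false _ = inj₂ ≤-refl
  neither-end (inj₂ S<U) _ _ false false _ = inj₂ (<⇒≤ S<U)
  neither-end (inj₁ refl) _ _ false true _ = inj₁ refl
  neither-end (inj₂ S<U) _ _ false true _ = inj₂ S<U
  neither-end _ bound-x _ true false pack = inj₂ (bound-x (centre-excludes pack x∼b))
  neither-end _ _ bound-xy true true pack =
    inj₂ (bound-xy (centre-excludes pack x∼b) (centre-excludes pack y∼b))

module Dichotomy {n} {G : Graph n} (simple : IsSimple G)
  {U : Subset n} (U-unique : IsUniqueMaxOpenPacking G U)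
  {x y : Fin n} (cut : IsCutEdge G x y) (x∉U : x ∉ U) (y∉U : y ∉ U)
  {u₁} (u₁∈U : u₁ ∈ U) (xu₁ : Adj G x u₁) {u₂} (u₂∈U : u₂ ∈ U) (yu₂ : Adj G y u₂) where

  open EdgeDeletion G x y
  open Subdivision G x y

  G-sym : ∀ u v → G u v ≡ G v u
  G-sym = proj₁ simple

  x≢y : x ≢ y
  x≢y refl with () ← trans (sym (proj₁ cut)) (proj₂ simple x)

  open Cut G-sym cut x≢y

  U-edge : ∀ {v z} → v ∈ U → Adj G z v → Adj H v z
  U-edge v∈U zv with G⊆H+xy (trans (G-sym _ _) zv)
  ... | inj₁ vz = vz
  ... | inj₂ (inj₁ (refl , _)) = contradiction v∈U x∉U
  ... | inj₂ (inj₂ (refl , _)) = contradiction v∈U y∉U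

  -- The complement of the component of x is the component side of y.
  ∁-closed : ∀ {u v} → Adj H u v → u ∈ ∁ component → v ∈ ∁ component
  ∁-closed uv u∈ = x∉p⇒x∈∁p λ v∈ → x∈∁p⇒x∉p u∈ (component-closed (H-sym G-sym uv) v∈)

  -- Splicing along the component of x, and symmetrically (with the roles of
  -- x and y exchanged) along its complement.
  module SplitX = Splicing (H-sym G-sym) G⊆H+xy x∈component y∉component component-closed
  module SplitY = Splicing (H-sym G-sym) (λ uv → map₂ swap (G⊆H+xy uv))
    (x∉p⇒x∈∁p y∉component) (x∈p⇒x∉∁p x∈component) ∁-closed

  module BoundsX = SplitX.Comparison H⊆G U-unique x∉U y∉U
    u₁∈U (U-edge u₁∈U xu₁) u₂∈U (U-edge u₂∈U yu₂)
  module BoundsY = SplitY.Comparison H⊆G U-unique y∉U x∉U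
    u₂∈U (U-edge u₂∈U yu₂) u₁∈U (U-edge u₁∈U xu₁)

  dichotomy : ∀ S → IsOpenPacking G′ S → S ≡ withLeaf U ⊎ ∣ S ∣ ≤ ∣ U ∣
  dichotomy (sb ∷ sa ∷ S) pack with restrict pack | x ∈? S | y ∈? S
  ... | _ | yes x∈ | yes y∈ = contradiction (not-both pack x∈ y∈) x≢y
  ... | S-pack | yes x∈ | no y∉ = inj₂ (one-end {U} x∈ x∼b y∼b
    (BoundsX.containing-bound S-pack x∈ y∉) (BoundsX.containing-bound-y S-pack x∈ y∉)
    sb sa pack)
  ... | S-pack | no x∉ | yes y∈ = inj₂ (one-end {U} y∈ y∼b x∼b
    (BoundsY.containing-bound S-pack y∈ x∉) (BoundsY.containing-bound-y S-pack y∈ x∉)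
    sb sa pack)
  ... | S-pack | no x∉ | no y∉ = neither-end (BoundsX.avoiding-bound S-pack x∉ y∉)
    (BoundsX.avoiding-bound-x S-pack x∉ y∉) (BoundsX.avoiding-bound-xy S-pack x∉ y∉)
    sb sa pack

mainTheorem17 : (n : ℕ) (G : Graph n) → IsSimple G →
    (U : Subset n) → IsUniqueMaxOpenPacking G U →
    (x y : Fin n) → IsCutEdge G x y →
    x ∉ U → y ∉ U →
    (∃[ u ] (u ∈ U × Adj G x u)) →
    (∃[ u ] (u ∈ U × Adj G y u)) →
    HasUniqueMaxOpenPacking (subdivideAddLeaf G x y)
mainTheorem17 n G simple U U-unique x y cut x∉U y∉U (u₁ , u₁∈U , xu₁) (u₂ , u₂∈U , yu₂) =
  withLeaf U ,
  unique-max-intro (extended-packing (proj₁ (proj₁ U-unique)) x∉U y∉U)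
    (λ S S-pack → map₂ s≤s (dichotomy S S-pack))
  where
  open Subdivision G x y
  open Dichotomy simple U-unique cut x∉U y∉U u₁∈U xu₁ u₂∈U yu₂
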